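{- Let $r \geq 3$, $q \geq 2$, let $(G,f)$ be a $q$-edge-colored graph, let $F$ be a $K_r$-template in $(G,f)$, and let $F^+$ be its blowup (as defined below). Then there are two $K_r$-tilings $\mathcal{T}^1, \mathcal{T}^2$ of $F^+$ and a color $c \in [q]$ such that $c$ appears on a different number of edges in $\mathcal{T}^1$ than in $\mathcal{T}^2$.
   Context: A $q$-edge-colored graph is a pair $(G,f)$ with $f : E(G) \to [q]$. For $K \subseteq V(G)$, $N(K)$ denotes the common neighborhood of $K$, i.e. the set of vertices adjacent to every vertex of $K$. An even cycle $C = w_1 w_2 \dots w_{2k} w_1$ is balanced if the multisets $\{f(w_1w_2), f(w_3w_4), \dots, f(w_{2k-1}w_{2k})\}$ and $\{f(w_2w_3), f(w_4w_5), \dots, f(w_{2k}w_1)\}$ are equal, and unbalanced otherwise. A $K_r$-template is a subgraph consisting of a copy $K$ of $K_{r-2}$ (the center) together with an unbalanced cycle of length $4$ or $6$ whose vertices lie in $N(K)$ (with all edges between $K$ and the cycle vertices, which exist). If the cycle has length $2k \in \{4,6\}$, $F^+$ is the edge-colored graph obtained from $F$ by replacing each center vertex by an independent set of size $k$ (cycle vertices remain single vertices) and each edge of $F$ by a complete bipartite graph between the corresponding sets, all of whose edges get the color of the original edge. A $K_r$-tiling of a graph is a collection of vertex-disjoint copies of $K_r$ whose vertex sets partition the vertex set. -}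

module Defs where

open import Data.Nat using (ℕ; zero; suc; _+_; _*_; _∸_; _<_; _≤_)
open import Data.Nat.DivMod using (_mod_; _%_)
open import Data.Fin using (Fin; toℕ) renaming (_<_ to _<ᶠ_)
import Data.Fin as F
import Data.Nat as N
open import Data.List using (List; map; filter; length; allFin; cartesianProduct)
open import Data.Nat.ListAction using (sum)
open import Data.List.Relation.Binary.Permutation.Propositional using (_↭_)
open import Data.Product using (Σ; _×_; _,_; proj₁; proj₂)
open import Data.Sum using (_⊎_; inj₁; inj₂)
open import Data.Unit using (⊤)
open import Relation.Binary.PropositionalEquality using (_≡_; _≢_)
open import Relation.Nullary using (¬_)
open import Function using (Injective; Surjective)

record SimpleGraph (n : ℕ) : Set₁ where
  field
    Adj       : Fin n → Fin n → Set
    symmetric : ∀ u v → Adj u v → Adj v u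
    irreflex  : ∀ v → ¬ Adj v v

-- A q-edge-colouring is encoded as a symmetric function on pairs of
-- vertices; only its values on edges matter.
IsEdgeColouring : ∀ {n} (q : ℕ) → (Fin n → Fin n → Fin q) → Set
IsEdgeColouring q f = ∀ u v → f u v ≡ f v u

next : ∀ {m} → Fin m → Fin m
next {suc m} i = suc (toℕ i) mod suc m

-- The cycle w_1 … w_{2k} w_1 is given by
-- w : Fin (2 * k) → Fin n, with w_{i+1} = w i (zero-based indices).  The edges w_1w_2, w_3w_4, … are the edges
-- with even zero-based index, the edges w_2w_3, …, w_{2k}w_1 those with
-- odd zero-based index.

module _ {n q : ℕ} (f : Fin n → Fin n → Fin q) where

  edgeColour : ∀ {k} → (Fin (2 * k) → Fin n) → Fin (2 * k) → Fin q
  edgeColour w i = f (w i) (w (next i))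

  firstClassColours : ∀ k → (Fin (2 * k) → Fin n) → List (Fin q)
  firstClassColours k w =
    map (edgeColour {k} w) (filter (λ i → toℕ i % 2 N.≟ 0) (allFin (2 * k)))

  secondClassColours : ∀ k → (Fin (2 * k) → Fin n) → List (Fin q)
  secondClassColours k w =
    map (edgeColour {k} w) (filter (λ i → toℕ i % 2 N.≟ 1) (allFin (2 * k)))

  -- multiset equality = equality up to permutation
  Balanced : ∀ k → (Fin (2 * k) → Fin n) → Set
  Balanced k w = firstClassColours k w ↭ secondClassColours k w

  Unbalanced : ∀ k → (Fin (2 * k) → Fin n) → Set
  Unbalanced k w = ¬ Balanced k w

record IsTemplate {n q : ℕ} (G : SimpleGraph n) (f : Fin n → Fin n → Fin q)
                  (r k : ℕ) (κ : Fin (r ∸ 2) → Fin n) (w : Fin (2 * k) → Fin n)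
                  : Set where
  open SimpleGraph G
  field
    length46      : k ≡ 2 ⊎ k ≡ 3
    center-inj    : Injective _≡_ _≡_ κ
    center-clique : ∀ a b → a ≢ b → Adj (κ a) (κ b)
    cycle-inj     : Injective _≡_ _≡_ w
    cycle-edges   : ∀ x → Adj (w x) (w (next x))
    disjoint      : ∀ a x → κ a ≢ w x
    cycle-in-N    : ∀ a x → Adj (κ a) (w x)
    unbalanced    : Unbalanced f k w

-- The blowup F⁺ of the template: each center vertex a is replaced by
-- the independent set {a} × Fin k; cycle vertices stay single.

BlowupVertex : (r k : ℕ) → Set
BlowupVertex r k = (Fin (r ∸ 2) × Fin k) ⊎ Fin (2 * k)

module _ {n q : ℕ} (f : Fin n → Fin n → Fin q) (r k : ℕ)
         (κ : Fin (r ∸ 2) → Fin n) (w : Fin (2 * k) → Fin n) where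

  BlowupAdj : BlowupVertex r k → BlowupVertex r k → Set
  BlowupAdj (inj₁ (a , _)) (inj₁ (b , _)) = a ≢ b
  BlowupAdj (inj₁ _)       (inj₂ _)       = ⊤
  BlowupAdj (inj₂ _)       (inj₁ _)       = ⊤
  BlowupAdj (inj₂ x)       (inj₂ y)       = (y ≡ next x) ⊎ (x ≡ next y)

  BlowupCol : BlowupVertex r k → BlowupVertex r k → Fin q
  BlowupCol (inj₁ (a , _)) (inj₁ (b , _)) = f (κ a) (κ b)
  BlowupCol (inj₁ (a , _)) (inj₂ y)       = f (κ a) (w y)
  BlowupCol (inj₂ x)       (inj₁ (b , _)) = f (w x) (κ b)
  BlowupCol (inj₂ x)       (inj₂ y)       = f (w x) (w y)

record Tiling {V : Set} (Adj : V → V → Set) (r : ℕ) : Set where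
  field
    m      : ℕ
    copy   : Fin m → Fin r → V
    clique : ∀ i j j' → j ≢ j' → Adj (copy i j) (copy i j')
    disj   : Injective _≡_ _≡_ (λ (p : Fin m × Fin r) → copy (proj₁ p) (proj₂ p))
    cover  : Surjective _≡_ _≡_ (λ (p : Fin m × Fin r) → copy (proj₁ p) (proj₂ p))

colourCount : ∀ {V : Set} {Adj : V → V → Set} {r q : ℕ}
              (col : V → V → Fin q) → Tiling Adj r → Fin q → ℕ
colourCount {r = r} col T c =
  sum (map (λ i → length (filter (λ p → col (copy i (proj₁ p)) (copy i (proj₂ p)) F.≟ c)
                                  (filter (λ p → proj₁ p F.<? proj₂ p)
                                          (cartesianProduct (allFin r) (allFin r)))))
           (allFin m))
  where open Tiling T

{-# OPTIONS --safe #-}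
module Submission where

-- Pair up the 2k cycle vertices of F⁺ along every other edge of the cycle, either along
-- w₁w₂, w₃w₄, … or along w₂w₃, …, w_{2k}w₁, and add to the i-th pair the i-th vertex of
-- each blown-up centre class; either way this tiles F⁺ by copies of K_r.  Apart from the
-- k chosen cycle edges, a tiling contains k copies of the centre clique and, for every cycle
-- vertex (each used exactly once), one copy of its star to the centre; so both tilings have
-- the same number of such edges of each colour.  Hence they differ in colour c exactly by
-- the difference of the multiplicities of c in the two colour classes of the cycle, and
-- equal counts for all colours would make the cycle balanced.

open import Defs
open import Data.Bool using (Bool; true; false; _∧_)
open import Data.Fin using (Fin; zero; suc; toℕ; _↑ˡ_)
import Data.Fin as Fin
import Data.Fin.Properties as Fin
open import Data.Fin.Patterns using (0F; 1F)
open import Data.List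
  using (List; []; _∷_; _++_; map; filter; length; allFin; tabulate; cartesianProduct; concatMap)
open import Data.List.Properties using (map-++; map-∘; map-cong; map-tabulate)
open import Data.List.Membership.Propositional using (_∈_)
open import Data.List.Membership.Propositional.Properties using (∈-∃++)
open import Data.List.Relation.Unary.Any using (here; there)
open import Data.List.Relation.Binary.Permutation.Propositional
  using (_↭_; ↭-refl; ↭-trans; ↭-sym; prep)
open import Data.List.Relation.Binary.Permutation.Propositional.Properties
  using (shift; map⁺; ++-comm)
open import Data.Nat as ℕ using (ℕ; suc; _+_; _*_; _∸_; _≤_; s≤s)
open import Data.Nat.DivMod using (_mod_; _/_)
open import Data.Nat.ListAction using (sum)
open import Data.Nat.ListAction.Properties using (sum-++; sum-↭)
open import Data.Nat.Properties using (+-assoc; +-cancelʳ-≡; +-cancelˡ-≡; +-commutativeSemigroup)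
open import Algebra.Properties.CommutativeSemigroup +-commutativeSemigroup
  using (interchange; x∙yz≈y∙xz)
open import Data.Product using (Σ; _×_; _,_; proj₁; proj₂; uncurry)
import Data.Product.Properties as Product
open import Data.Sum using (inj₁; inj₂)
open import Data.Unit using (tt)
open import Function using (_∘_; id)
open import Function.Consequences.Propositional
  using (inverseʳ⇒injective; inverseˡ⇒surjective; strictlyInverseʳ⇒inverseʳ; strictlyInverseˡ⇒inverseˡ)
open import Relation.Binary.Definitions using (DecidableEquality)
open import Relation.Binary.PropositionalEquality
open import Relation.Nullary using (Dec; does; yes; no; ¬_; _×-dec_; contradiction)
open import Relation.Nullary.Decidable using (True; toWitness; dec-true)

private
  variable
    A B : Set

indicator : Bool → ℕ
indicator true  = 1
indicator false = 0

count : (A → Bool) → List A → ℕ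
count p xs = sum (map (indicator ∘ p) xs)

sum-map-+ : (g h : A → ℕ) (xs : List A) →
            sum (map (λ x → g x + h x) xs) ≡ sum (map g xs) + sum (map h xs)
sum-map-+ g h []       = refl
sum-map-+ g h (x ∷ xs) = trans (cong (g x + h x +_) (sum-map-+ g h xs))
                               (interchange (g x) (h x) _ _)

sum-map-concatMap-pair : (g : B → ℕ) (u v : A → B) (xs : List A) →
  sum (map g (concatMap (λ x → u x ∷ v x ∷ []) xs)) ≡ sum (map (λ x → g (u x) + g (v x)) xs)
sum-map-concatMap-pair g u v []       = refl
sum-map-concatMap-pair g u v (x ∷ xs) =
  trans (cong (λ s → g (u x) + (g (v x) + s)) (sum-map-concatMap-pair g u v xs))
        (sym (+-assoc (g (u x)) (g (v x)) _))

sum-map-allFin-suc : ∀ {t} (g : Fin (suc t) → ℕ) →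
  sum (map g (allFin (suc t))) ≡ g zero + sum (map (g ∘ suc) (allFin t))
sum-map-allFin-suc g =
  cong (λ xs → g zero + sum xs) (trans (map-tabulate suc g) (sym (map-tabulate id (g ∘ suc))))

count-++ : (p : A → Bool) (xs ys : List A) → count p (xs ++ ys) ≡ count p xs + count p ys
count-++ p xs ys =
  trans (cong sum (map-++ (indicator ∘ p) xs ys)) (sum-++ (map (indicator ∘ p) xs) _)

count-map : (p : B → Bool) (g : A → B) (xs : List A) → count p (map g xs) ≡ count (p ∘ g) xs
count-map p g xs = cong sum (sym (map-∘ xs))

count-cartesianProduct : (p : A × B → Bool) (xs : List A) (ys : List B) →
  count p (cartesianProduct xs ys) ≡ sum (map (λ x → count (λ y → p (x , y)) ys) xs)
count-cartesianProduct p []       ys = refl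
count-cartesianProduct p (x ∷ xs) ys = begin
  count p (map (x ,_) ys ++ cartesianProduct xs ys)
    ≡⟨ count-++ p (map (x ,_) ys) (cartesianProduct xs ys) ⟩
  count p (map (x ,_) ys) + count p (cartesianProduct xs ys)
    ≡⟨ cong₂ _+_ (count-map p (x ,_) ys) (count-cartesianProduct p xs ys) ⟩
  count (λ y → p (x , y)) ys + sum (map (λ x → count (λ y → p (x , y)) ys) xs) ∎
  where open ≡-Reasoning

length-filter-filter : {P Q : A → Set} (P? : ∀ x → Dec (P x)) (Q? : ∀ x → Dec (Q x))
  (xs : List A) → length (filter P? (filter Q? xs)) ≡ count (λ x → does (Q? x) ∧ does (P? x)) xs
length-filter-filter P? Q? [] = refl
length-filter-filter P? Q? (x ∷ xs) with does (Q? x)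
... | false = length-filter-filter P? Q? xs
... | true with does (P? x)
...   | false = length-filter-filter P? Q? xs
...   | true  = cong suc (length-filter-filter P? Q? xs)

module _ (_≟_ : DecidableEquality A) where

  occurrences : A → List A → ℕ
  occurrences a = count (λ x → does (x ≟ a))

  occurrences-here : ∀ a xs → occurrences a (a ∷ xs) ≡ suc (occurrences a xs)
  occurrences-here a xs = cong (λ b → indicator b + occurrences a xs) (dec-true (a ≟ a) refl)

  occurs⇒∈ : ∀ {a n} xs → occurrences a xs ≡ suc n → a ∈ xs
  occurs⇒∈ {a} (x ∷ xs) occ with x ≟ a
  ... | yes refl = here refl
  ... | no _     = there (occurs⇒∈ xs occ)

  occurrences⇒↭ : ∀ xs ys → (∀ a → occurrences a xs ≡ occurrences a ys) → xs ↭ ys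
  occurrences⇒↭ []       []       _    = ↭-refl
  occurrences⇒↭ []       (y ∷ ys) same with () ← trans (same y) (occurrences-here y ys)
  occurrences⇒↭ (x ∷ xs) ys       same
    with as , bs , refl ← ∈-∃++ (occurs⇒∈ ys (trans (sym (same x)) (occurrences-here x xs)))
    = ↭-trans (prep x (occurrences⇒↭ xs (as ++ bs) same′)) (↭-sym (shift x as bs))
    where
    same′ : ∀ a → occurrences a xs ≡ occurrences a (as ++ bs)
    same′ a = +-cancelˡ-≡ (δ x) _ _ (begin
      δ x + occurrences a xs                       ≡⟨ same a ⟩
      occurrences a (as ++ x ∷ bs)                 ≡⟨ count-++ is-a as (x ∷ bs) ⟩
      occurrences a as + (δ x + occurrences a bs)  ≡⟨ x∙yz≈y∙xz (occurrences a as) (δ x) _ ⟩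
      δ x + (occurrences a as + occurrences a bs)  ≡⟨ cong (δ x +_) (count-++ is-a as bs) ⟨
      δ x + occurrences a (as ++ bs)               ∎)
      where
      open ≡-Reasoning
      is-a : A → Bool
      is-a y = does (y ≟ a)
      δ : A → ℕ
      δ = indicator ∘ is-a

module _ {q : ℕ} (c : Fin q) where

  hit : Fin q → ℕ
  hit d = indicator (does (d Fin.≟ c))

  rowColourCount : ∀ {t} → (Fin t → Fin q) → ℕ
  rowColourCount g = sum (map (hit ∘ g) (allFin _))

  cliqueColourCount : ∀ {t} → (Fin t → Fin t → Fin q) → ℕ
  cliqueColourCount {t} G =
    length (filter (λ p → G (proj₁ p) (proj₂ p) Fin.≟ c)
                   (filter (λ p → proj₁ p Fin.<? proj₂ p) (cartesianProduct (allFin t) (allFin t))))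

  private
    upperHit : ∀ {t} → (Fin t → Fin t → Fin q) → Fin t → Fin t → Bool
    upperHit G i j = does (i Fin.<? j) ∧ does (G i j Fin.≟ c)

    cliqueColourCount-byRows : ∀ {t} (G : Fin t → Fin t → Fin q) →
      cliqueColourCount G ≡ sum (map (λ i → count (upperHit G i) (allFin t)) (allFin t))
    cliqueColourCount-byRows {t} G =
      trans (length-filter-filter _ _ (cartesianProduct (allFin t) (allFin t)))
            (count-cartesianProduct (uncurry (upperHit G)) (allFin t) (allFin t))

  -- By computation, (0, 0) and (suc i, 0) are not upper pairs, (0, suc j) is, and
  -- (suc i, suc j) is upper iff (i, j) is.
  cliqueColourCount-suc : ∀ {t} (G : Fin (suc t) → Fin (suc t) → Fin q) →
    cliqueColourCount G ≡
      rowColourCount (λ j → G zero (suc j)) + cliqueColourCount (λ i j → G (suc i) (suc j))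
  cliqueColourCount-suc {t} G = begin
    cliqueColourCount G
      ≡⟨ cliqueColourCount-byRows G ⟩
    sum (map row (allFin (suc t)))
      ≡⟨ sum-map-allFin-suc row ⟩
    row zero + sum (map (row ∘ suc) (allFin t))
      ≡⟨ cong₂ _+_ (sum-map-allFin-suc (indicator ∘ upperHit G zero))
                   (cong sum (map-cong (λ i → sum-map-allFin-suc (indicator ∘ upperHit G (suc i)))
                                       (allFin t))) ⟩
    rowColourCount (λ j → G zero (suc j)) +
      sum (map (λ i → count (upperHit G′ i) (allFin t)) (allFin t))
      ≡⟨ cong (rowColourCount (λ j → G zero (suc j)) +_) (cliqueColourCount-byRows G′) ⟨
    rowColourCount (λ j → G zero (suc j)) + cliqueColourCount G′ ∎
    where
    open ≡-Reasoning
    row : Fin (suc t) → ℕ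
    row i = count (upperHit G i) (allFin (suc t))
    G′ : Fin t → Fin t → Fin q
    G′ i j = G (suc i) (suc j)

  cliqueColourCount-2+ : ∀ {t} (G : Fin (2 + t) → Fin (2 + t) → Fin q) →
    cliqueColourCount G ≡
      hit (G 0F 1F) + (rowColourCount (λ a → G 0F (suc (suc a))) +
        (rowColourCount (λ a → G 1F (suc (suc a))) +
          cliqueColourCount (λ a b → G (suc (suc a)) (suc (suc b)))))
  cliqueColourCount-2+ G = begin
    cliqueColourCount G
      ≡⟨ cliqueColourCount-suc G ⟩
    rowColourCount (λ j → G 0F (suc j)) + cliqueColourCount (λ i j → G (suc i) (suc j))
      ≡⟨ cong₂ _+_ (sum-map-allFin-suc (λ j → hit (G 0F (suc j))))
                   (cliqueColourCount-suc (λ i j → G (suc i) (suc j))) ⟩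
    (hit (G 0F 1F) + rowColourCount (λ a → G 0F (suc (suc a)))) + rest
      ≡⟨ +-assoc (hit (G 0F 1F)) _ rest ⟩
    hit (G 0F 1F) + (rowColourCount (λ a → G 0F (suc (suc a))) + rest) ∎
    where
    open ≡-Reasoning
    rest : ℕ
    rest = rowColourCount (λ a → G 1F (suc (suc a)))
         + cliqueColourCount (λ a b → G (suc (suc a)) (suc (suc b)))

-- endpoints-↭ follows from the inverse laws; it is the form in which the counting uses them.
record CycleMatching (k : ℕ) : Set where
  field
    endpoint        : Fin k → Fin 2 → Fin (2 * k)
    edgeOf          : Fin (2 * k) → Fin k × Fin 2
    consecutive     : ∀ i → endpoint i 1F ≡ next (endpoint i 0F)
    endpoint-edgeOf : ∀ x → uncurry endpoint (edgeOf x) ≡ x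
    edgeOf-endpoint : ∀ i j → edgeOf (endpoint i j) ≡ (i , j)
    endpoints-↭     : concatMap (λ i → endpoint i 0F ∷ endpoint i 1F ∷ []) (allFin k) ↭ allFin (2 * k)

module MatchingTiling {n q t k : ℕ} (f : Fin n → Fin n → Fin q)
  (κ : Fin t → Fin n) (w : Fin (2 * k) → Fin n) (M : CycleMatching k) where

  open CycleMatching M

  copy : Fin k → Fin (2 + t) → BlowupVertex (2 + t) k
  copy i 0F            = inj₂ (endpoint i 0F)
  copy i 1F            = inj₂ (endpoint i 1F)
  copy i (suc (suc a)) = inj₁ (a , i)

  position : BlowupVertex (2 + t) k → Fin k × Fin (2 + t)
  position (inj₁ (a , i)) = i , suc (suc a)
  position (inj₂ x)       = proj₁ (edgeOf x) , proj₂ (edgeOf x) ↑ˡ t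

  position-copy : ∀ i j → position (copy i j) ≡ (i , j)
  position-copy i 0F            = cong (λ p → proj₁ p , proj₂ p ↑ˡ t) (edgeOf-endpoint i 0F)
  position-copy i 1F            = cong (λ p → proj₁ p , proj₂ p ↑ˡ t) (edgeOf-endpoint i 1F)
  position-copy i (suc (suc a)) = refl

  copy-position : ∀ v → uncurry copy (position v) ≡ v
  copy-position (inj₁ _) = refl
  copy-position (inj₂ x) with edgeOf x | endpoint-edgeOf x
  ... | i , 0F | e = cong inj₂ e
  ... | i , 1F | e = cong inj₂ e

  copy-clique : ∀ i j j′ → j ≢ j′ → BlowupAdj f (2 + t) k κ w (copy i j) (copy i j′)
  copy-clique i 0F            0F            j≢j′ = contradiction refl j≢j′
  copy-clique i 0F            1F            _    = inj₁ (consecutive i)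
  copy-clique i 1F            0F            _    = inj₂ (consecutive i)
  copy-clique i 1F            1F            j≢j′ = contradiction refl j≢j′
  copy-clique i 0F            (suc (suc _)) _    = tt
  copy-clique i 1F            (suc (suc _)) _    = tt
  copy-clique i (suc (suc _)) 0F            _    = tt
  copy-clique i (suc (suc _)) 1F            _    = tt
  copy-clique i (suc (suc a)) (suc (suc b)) j≢j′ = j≢j′ ∘ cong (λ a → Fin.suc (Fin.suc a))

  tiling : Tiling (BlowupAdj f (2 + t) k κ w) (2 + t)
  tiling = record
    { m      = k
    ; copy   = copy
    ; clique = copy-clique
    ; disj   = inverseʳ⇒injective (uncurry copy)
                 (strictlyInverseʳ⇒inverseʳ {f⁻¹ = position} (uncurry copy) (uncurry position-copy))
    ; cover  = inverseˡ⇒surjective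
                 (strictlyInverseˡ⇒inverseˡ {f⁻¹ = position} (uncurry copy) copy-position)
    }

  matchedColours : List (Fin q)
  matchedColours = map (λ i → f (w (endpoint i 0F)) (w (endpoint i 1F))) (allFin k)

  module _ (c : Fin q) where

    centreDegree : Fin (2 * k) → ℕ
    centreDegree x = rowColourCount c (λ a → f (w x) (κ a))

    centreColourCount : ℕ
    centreColourCount = cliqueColourCount c (λ a b → f (κ a) (κ b))

    offCycleColourCount : Fin k → ℕ
    offCycleColourCount i =
      centreDegree (endpoint i 0F) + (centreDegree (endpoint i 1F) + centreColourCount)

    sum-offCycleColourCount : sum (map offCycleColourCount (allFin k)) ≡
      sum (map centreDegree (allFin (2 * k))) + sum (map (λ _ → centreColourCount) (allFin k))
    sum-offCycleColourCount = begin
      sum (map offCycleColourCount (allFin k))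
        ≡⟨ cong sum (map-cong (λ i → +-assoc (ρ₀ i) (ρ₁ i) centreColourCount) (allFin k)) ⟨
      sum (map (λ i → (ρ₀ i + ρ₁ i) + centreColourCount) (allFin k))
        ≡⟨ sum-map-+ (λ i → ρ₀ i + ρ₁ i) (λ _ → centreColourCount) (allFin k) ⟩
      sum (map (λ i → ρ₀ i + ρ₁ i) (allFin k)) + centreTotal
        ≡⟨ cong (_+ centreTotal) (sum-map-concatMap-pair centreDegree _ _ (allFin k)) ⟨
      sum (map centreDegree (concatMap (λ i → endpoint i 0F ∷ endpoint i 1F ∷ []) (allFin k)))
        + centreTotal
        ≡⟨ cong (_+ centreTotal) (sum-↭ (map⁺ centreDegree endpoints-↭)) ⟩
      sum (map centreDegree (allFin (2 * k))) + centreTotal ∎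
      where
      open ≡-Reasoning
      ρ₀ ρ₁ : Fin k → ℕ
      ρ₀ i = centreDegree (endpoint i 0F)
      ρ₁ i = centreDegree (endpoint i 1F)
      centreTotal : ℕ
      centreTotal = sum (map (λ _ → centreColourCount) (allFin k))

    colourCount-tiling : colourCount (BlowupCol f (2 + t) k κ w) tiling c ≡
      occurrences Fin._≟_ c matchedColours +
        (sum (map centreDegree (allFin (2 * k))) + sum (map (λ _ → centreColourCount) (allFin k)))
    colourCount-tiling = begin
      colourCount (BlowupCol f (2 + t) k κ w) tiling c
        ≡⟨ cong sum (map-cong (λ i → cliqueColourCount-2+ c (copyColouring i)) (allFin k)) ⟩
      sum (map (λ i → hit c (cycleColour i) + offCycleColourCount i) (allFin k))
        ≡⟨ sum-map-+ (hit c ∘ cycleColour) offCycleColourCount (allFin k) ⟩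
      sum (map (hit c ∘ cycleColour) (allFin k)) + sum (map offCycleColourCount (allFin k))
        ≡⟨ cong₂ _+_ (count-map (λ d → does (d Fin.≟ c)) cycleColour (allFin k))
                     (sym sum-offCycleColourCount) ⟨
      occurrences Fin._≟_ c matchedColours +
        (sum (map centreDegree (allFin (2 * k))) + sum (map (λ _ → centreColourCount) (allFin k))) ∎
      where
      open ≡-Reasoning
      copyColouring : Fin k → Fin (2 + t) → Fin (2 + t) → Fin q
      copyColouring i j j′ = BlowupCol f (2 + t) k κ w (copy i j) (copy i j′)
      cycleColour : Fin k → Fin q
      cycleColour i = f (w (endpoint i 0F)) (w (endpoint i 1F))

colourCounts-differ : ∀ {n q t k} (f : Fin n → Fin n → Fin q) (κ : Fin t → Fin n)
  (w : Fin (2 * k) → Fin n) (M N : CycleMatching k) →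
  ¬ (MatchingTiling.matchedColours f κ w M ↭ MatchingTiling.matchedColours f κ w N) →
  Σ (Tiling (BlowupAdj f (2 + t) k κ w) (2 + t)) λ T₁ →
  Σ (Tiling (BlowupAdj f (2 + t) k κ w) (2 + t)) λ T₂ →
  Σ (Fin q) λ c →
    colourCount (BlowupCol f (2 + t) k κ w) T₁ c ≢ colourCount (BlowupCol f (2 + t) k κ w) T₂ c
colourCounts-differ {q = q} {t} {k} f κ w M N different =
  TM.tiling , TN.tiling ,
  Fin.¬∀⟶∃¬ q _ (λ c → colourCount col TM.tiling c ℕ.≟ colourCount col TN.tiling c) λ same →
    different (occurrences⇒↭ Fin._≟_ _ _ λ c →
      +-cancelʳ-≡ _ _ _
        (trans (sym (TM.colourCount-tiling c)) (trans (same c) (TN.colourCount-tiling c))))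
  where
  module TM = MatchingTiling f κ w M
  module TN = MatchingTiling f κ w N
  col : BlowupVertex (2 + t) k → BlowupVertex (2 + t) k → Fin q
  col = BlowupCol f (2 + t) k κ w

allFin-rotate-↭ : ∀ n → tabulate {n = n} suc ++ zero ∷ [] ↭ allFin (suc n)
allFin-rotate-↭ n = ++-comm (tabulate suc) (zero ∷ [])

-- The matching with edges {2i + o, 2i + o + 1} (mod 2k); in alternatingEdgeOf,
-- y ≡ x − o (mod 2k) is written without truncated subtraction (for o ≤ 2k).
alternatingEndpoint : ∀ k → ℕ → Fin k → Fin 2 → Fin (2 * k)
alternatingEndpoint (suc k) o i j = (o + 2 * toℕ i + toℕ j) mod (2 * suc k)

alternatingEdgeOf : ∀ k → ℕ → Fin (2 * k) → Fin k × Fin 2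
alternatingEdgeOf (suc k) o x = (y / 2) mod suc k , y mod 2
  where
  y : ℕ
  y = toℕ x + (2 * suc k ∸ o)

module _ (k o : ℕ) where

  private
    endpoint : Fin k → Fin 2 → Fin (2 * k)
    endpoint = alternatingEndpoint k o

    edgeOf : Fin (2 * k) → Fin k × Fin 2
    edgeOf = alternatingEdgeOf k o

  alternatingLaws : Dec ((∀ i → endpoint i 1F ≡ next (endpoint i 0F))
                       × (∀ x → uncurry endpoint (edgeOf x) ≡ x)
                       × (∀ i j → edgeOf (endpoint i j) ≡ (i , j)))
  alternatingLaws =
    Fin.all? (λ i → endpoint i 1F Fin.≟ next (endpoint i 0F)) ×-dec
    Fin.all? (λ x → uncurry endpoint (edgeOf x) Fin.≟ x) ×-dec
    Fin.all? (λ i → Fin.all? λ j → Product.≡-dec Fin._≟_ Fin._≟_ (edgeOf (endpoint i j)) (i , j))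

  alternatingMatching : True alternatingLaws →
    concatMap (λ i → endpoint i 0F ∷ endpoint i 1F ∷ []) (allFin k) ↭ allFin (2 * k) →
    CycleMatching k
  alternatingMatching laws endpoints-↭
    with consecutive , endpoint-edgeOf , edgeOf-endpoint ← toWitness laws = record
    { endpoint        = endpoint
    ; edgeOf          = edgeOf
    ; consecutive     = consecutive
    ; endpoint-edgeOf = endpoint-edgeOf
    ; edgeOf-endpoint = edgeOf-endpoint
    ; endpoints-↭     = endpoints-↭
    }

lemma3p3 : (r q n : ℕ) → 3 ≤ r → 2 ≤ q →
    (G : SimpleGraph n) (f : Fin n → Fin n → Fin q) → IsEdgeColouring q f →
    (k : ℕ) (κ : Fin (r ∸ 2) → Fin n) (w : Fin (2 * k) → Fin n) →
    IsTemplate G f r k κ w →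
    Σ (Tiling (BlowupAdj f r k κ w) r) λ T₁ →
    Σ (Tiling (BlowupAdj f r k κ w) r) λ T₂ →
    Σ (Fin q) λ c →
    colourCount (BlowupCol f r k κ w) T₁ c ≢ colourCount (BlowupCol f r k κ w) T₂ c
-- For k = 2, 3 the matched colours of the
-- alternating matchings with offsets 0 and 1 compute to firstClassColours k w and
-- secondClassColours k w, and the laws of these matchings are checked by evaluation.
lemma3p3 (suc (suc t)) _ _ (s≤s (s≤s _)) _ _ f _ k κ w template
  with IsTemplate.length46 template | IsTemplate.unbalanced template
... | inj₁ refl | unbalanced = colourCounts-differ f κ w
  (alternatingMatching 2 0 _ ↭-refl) (alternatingMatching 2 1 _ (allFin-rotate-↭ 3)) unbalanced
... | inj₂ refl | unbalanced = colourCounts-differ f κ w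
  (alternatingMatching 3 0 _ ↭-refl) (alternatingMatching 3 1 _ (allFin-rotate-↭ 5)) unbalanced
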